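{- For every real $R>3/2$ and every $\epsilon>0$, the competitive ratio of the proportional\&non-removable online knapsack problem with a buffer of capacity $R$ is at least $2-\epsilon$.
   Context: Online knapsack problem with a resource buffer: there is a knapsack of capacity $1$ and a buffer of capacity $R\ge 1$. Items $e_1,\dots,e_n$ arrive one by one; each item $e$ has size $0<s(e)\le 1$ and value $v(e)\ge 0$; $s(B),v(B)$ denote sums over a set $B$. A deterministic online algorithm maintains buffer contents $B_0=\emptyset,B_1,\dots,B_n$, with $B_i$ chosen after seeing only $e_1,\dots,e_i$, $B_i\subseteq B_{i-1}\cup\{e_i\}$, $s(B_i)\le R$; in the non-removable setting additionally $B_{i-1}\subseteq B_i$. $\mathrm{ALG}(I)=\max\{v(B)\mid B\subseteq B_n,\ s(B)\le 1\}$, $\mathrm{OPT}(I)=\max\{v(B)\mid B\subseteq\{e_1,\dots,e_n\},\ s(B)\le 1\}$. "Proportional" means $v(e)=s(e)$ for every item. The competitive ratio of an algorithm is $\sup_I \mathrm{OPT}(I)/\mathrm{ALG}(I)$ (with $a/0=\infty$ for $a>0$), and the competitive ratio of the problem is the infimum of this over all deterministic online algorithms.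
   Formalization: The buffer capacity R, the parameter ε and all item sizes are rational instead of real, so the online algorithms act on instances with rational item sizes. -}

module Defs where

open import Data.Bool using (Bool; true; false; if_then_else_)
open import Data.List using (List; []; _∷_; _++_; [_]; map; foldr; filter)
open import Data.List.Relation.Unary.All using (All)
open import Data.Product using (_×_)
open import Data.Integer using (+_)
open import Data.Rational using (ℚ; 0ℚ; 1ℚ; _+_; _≤_; _<_; _⊔_; _/_)
open import Data.Rational.Properties using (_≤?_)

-- Proportional setting: an item is identified with its size s(e) = v(e).
-- An item is admissible when 0 < s ≤ 1.
ValidItem : ℚ → Set
ValidItem s = (0ℚ < s) × (s ≤ 1ℚ)

ValidInstance : List ℚ → Set
ValidInstance I = All ValidItem I

size : List ℚ → ℚ
size = foldr _+_ 0ℚ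

subsets : List ℚ → List (List ℚ)
subsets []       = [] ∷ []
subsets (x ∷ xs) = subsets xs ++ map (x ∷_) (subsets xs)

bestPacking : List ℚ → ℚ
bestPacking L = foldr _⊔_ 0ℚ (filter (λ q → q ≤? 1ℚ) (map size (subsets L)))

-- A deterministic online algorithm for the non-removable setting: on arrival of
-- item eᵢ it sees the history e₁,…,eᵢ₋₁ and eᵢ, and decides whether to put eᵢ
-- into the buffer (true) or discard it forever (false). Its previous decisions
-- are themselves functions of the history, so this is fully general.
OnlineAlg : Set
OnlineAlg = List ℚ → ℚ → Bool

runFrom : OnlineAlg → List ℚ → List ℚ → List ℚ
runFrom A h []       = []
runFrom A h (x ∷ xs) =
  if A h x then x ∷ runFrom A (h ++ [ x ]) xs else runFrom A (h ++ [ x ]) xs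

buffer : OnlineAlg → List ℚ → List ℚ
buffer A I = runFrom A [] I

-- Feasibility w.r.t. buffer capacity R: on every instance the buffer never
-- exceeds R. (Every prefix of an instance is an instance, and the buffer of a
-- prefix is the buffer at that time, so this covers s(Bᵢ) ≤ R for all i.)
Feasible : ℚ → OnlineAlg → Set
Feasible R A = (I : List ℚ) → ValidInstance I → size (buffer A I) ≤ R

ALG : OnlineAlg → List ℚ → ℚ
ALG A I = bestPacking (buffer A I)

OPT : List ℚ → ℚ
OPT I = bestPacking I

-- The competitive ratio sup_I OPT(I)/ALG(I) of A is ≥ c.
-- For c' ≥ 0: OPT/ALG > c'  ⇔  c'·ALG < OPT  (with a/0 = ∞ for a > 0, and
-- instances with OPT = ALG = 0 never witnessing anything). Hence sup ≥ c iff
-- for every c' < c some instance has c'·ALG(I) < OPT(I).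
RatioAtLeast : OnlineAlg → ℚ → Set
RatioAtLeast A c =
  (c' : ℚ) → c' < c →
  Data.Product.∃ λ I → ValidInstance I × (c' Data.Rational.* ALG A I < OPT I)

three-halves : ℚ
three-halves = + 3 / 2

two : ℚ
two = + 2 / 1

module Submission where

-- Lower bound 2 for proportional, non-removable online knapsack with a
-- buffer of any capacity R (the argument never uses R > 3/2).
--
-- Fix 0 < η < ½ and feed the items  aⱼ = ½ + ηⱼ  (j = 0,1,…),
-- where η₀ = η and ηⱼ₊₁ = ηⱼ/2.  Any two a's sum to more than 1, so a
-- feasible algorithm cannot keep all of them (their total size exceeds R
-- eventually); let aₖ be the first rejected item and send next its
-- complement bₖ = ½ - ηₖ.  Then OPT ≥ aₖ + bₖ = 1, while the buffer is a
-- sublist of a₀,…,aₖ₋₁,bₖ, in which every two items sum to more than 1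
-- (aᵢ + bₖ = 1 + ηᵢ - ηₖ); hence the best packing of the buffer is a single
-- item and ALG ≤ ½ + η.  Letting η → 0 gives ratio → 2.

open import Defs
open import Data.Rational using (ℚ; 0ℚ; _<_; _-_)

open import Data.Bool using (true; false)
open import Data.Empty using (⊥-elim)
open import Data.Sum using (_⊎_; inj₁; inj₂)
open import Data.Product using (_×_; _,_; ∃; proj₁; proj₂)
open import Data.List using (List; []; _∷_; _++_; [_]; map; foldr; filter)
open import Data.List.Properties using (++-assoc; ++-identityʳ)
open import Data.List.Membership.Propositional using (_∈_)
open import Data.List.Membership.Propositional.Properties
  using (∈-++⁺ˡ; ∈-++⁺ʳ; ∈-++⁻; ∈-map⁺; ∈-map⁻; ∈-filter⁺; ∈-filter⁻)
open import Data.List.Relation.Unary.Any using (here; there)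
open import Data.List.Relation.Unary.All as All using (All; []; _∷_)
import Data.List.Relation.Unary.All.Properties as All
open import Data.List.Relation.Unary.AllPairs using (AllPairs; []; _∷_)
import Data.List.Relation.Unary.AllPairs.Properties as AllPairs
open import Data.List.Relation.Binary.Sublist.Propositional
  using (_⊆_; []; _∷_; _∷ʳ_; ⊆-refl; ⊆-trans)
open import Data.List.Relation.Binary.Sublist.Propositional.Properties
  using (All-resp-⊆; ++⁺; ++⁺ˡ)
open import Data.Nat as ℕ using (ℕ; zero; suc)
import Data.Nat.Properties as ℕ
open import Data.Integer as ℤ using (-[1+_])
import Data.Integer.Properties as ℤ
open import Data.Rational as ℚ
  using (1ℚ; ½; _+_; _*_; _≤_; _⊔_; -_; mkℚ; toℚᵘ; positive; nonNegative; nonPositive)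
open import Data.Rational.Properties
open import Data.Rational.Unnormalised as ℚᵘ using (mkℚᵘ)
import Data.Rational.Unnormalised.Properties as ℚᵘ
open import Data.Rational.Solver using (module +-*-Solver)
open import Relation.Nullary using (yes; no)
open import Relation.Nullary.Decidable using (True; toWitness)
open import Relation.Binary.PropositionalEquality
  using (_≡_; refl; sym; trans; cong; subst; subst₂; module ≡-Reasoning)

open +-*-Solver

literal< : ∀ p q → {True (p <? q)} → p < q
literal< p q {p<q} = toWitness p<q

0<q-p : ∀ {p q} → p < q → 0ℚ < q - p
0<q-p {p} {q} p<q = subst (_< q - p) (+-inverseʳ p) (+-monoˡ-< (- p) p<q)

0<q-p⇒p<q : ∀ {p q} → 0ℚ < q - p → p < q
0<q-p⇒p<q {p} {q} 0<q-p = subst₂ _<_ (+-identityʳ p) (p+[q-p]≡q p q) (+-monoʳ-< p 0<q-p)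
  where
  p+[q-p]≡q : ∀ p q → p + (q - p) ≡ q
  p+[q-p]≡q = solve 2 (λ p q → p :+ (q :- p) := q) refl

p-e<p : ∀ {p e} → 0ℚ < e → p - e < p
p-e<p {p} 0<e = subst (p - _ <_) (+-identityʳ p) (+-monoʳ-< p (neg-antimono-< 0<e))

0<* : ∀ {p q} → 0ℚ < p → 0ℚ < q → 0ℚ < p * q
0<* {p} {q} 0<p 0<q = positive⁻¹ _ {{pos*pos⇒pos p {{positive 0<p}} q {{positive 0<q}}}}

nat : ℕ → ℚ
nat zero    = 0ℚ
nat (suc n) = nat n + 1ℚ

-- nat n is the fraction n/1, so comparisons with it reduce to integers.
toℚᵘ-nat : ∀ n → toℚᵘ (nat n) ℚᵘ.≃ mkℚᵘ (ℤ.+ n) 0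
toℚᵘ-nat zero    = ℚᵘ.≃-refl
toℚᵘ-nat (suc n) = ℚᵘ.≃-trans (toℚᵘ-homo-+ (nat n) 1ℚ)
  (ℚᵘ.≃-trans (ℚᵘ.+-cong {y = mkℚᵘ (ℤ.+ n) 0} {v = mkℚᵘ (ℤ.+ 1) 0} (toℚᵘ-nat n) (ℚᵘ.*≡* refl))
              (ℚᵘ.*≡* n+1≡1+n))
  where
  n+1≡1+n : (ℤ.+ n ℤ.* ℤ.+ 1 ℤ.+ ℤ.+ 1 ℤ.* ℤ.+ 1) ℤ.* ℤ.+ 1 ≡ ℤ.+ suc n ℤ.* (ℤ.+ 1 ℤ.* ℤ.+ 1)
  n+1≡1+n = trans (ℤ.*-identityʳ _) (trans (cong (ℤ._+ ℤ.+ 1) (ℤ.*-identityʳ (ℤ.+ n)))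
              (trans (cong ℤ.+_ (ℕ.+-comm n 1)) (sym (ℤ.*-identityʳ _))))

-- A rational m/(d+1) is below the natural number m + 1.
archimedean : ∀ p → ∃ λ n → p < nat n
archimedean (mkℚ (ℤ.+ m) d _) =
  suc m , toℚᵘ-cancel-< (ℚᵘ.<-respʳ-≃ (ℚᵘ.≃-sym (toℚᵘ-nat (suc m))) (ℚᵘ.*<* m<[1+m][1+d]))
  where
  m<[1+m][1+d] : ℤ.+ m ℤ.* ℤ.+ 1 ℤ.< ℤ.+ suc m ℤ.* ℤ.+ suc d
  m<[1+m][1+d] = subst₂ ℤ._<_ (ℤ.pos-* m 1) (ℤ.pos-* (suc m) (suc d))
    (ℤ.+<+ (ℕ.≤-trans (ℕ.s≤s (ℕ.≤-reflexive (ℕ.*-identityʳ m))) (ℕ.m≤m*n (suc m) (suc d))))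
archimedean (mkℚ -[1+ m ] _ _) =
  0 , toℚᵘ-cancel-< (ℚᵘ.<-respʳ-≃ (ℚᵘ.≃-sym (toℚᵘ-nat 0)) (ℚᵘ.*<* ℤ.-<+))

size-++ : ∀ xs ys → size (xs ++ ys) ≡ size xs + size ys
size-++ []       ys = sym (+-identityˡ _)
size-++ (x ∷ xs) ys = trans (cong (x +_) (size-++ xs ys)) (sym (+-assoc x _ _))

size-nonneg : ∀ {S} → All (0ℚ ≤_) S → 0ℚ ≤ size S
size-nonneg []         = ≤-refl
size-nonneg (0≤x ∷ ps) = +-mono-≤ 0≤x (size-nonneg ps)

∈-subsets⇒⊆ : ∀ {S} L → S ∈ subsets L → S ⊆ L
∈-subsets⇒⊆ []       (here refl) = []
∈-subsets⇒⊆ (x ∷ L) S∈ with ∈-++⁻ (subsets L) S∈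
... | inj₁ S∈L  = x ∷ʳ ∈-subsets⇒⊆ L S∈L
... | inj₂ S∈xL with ∈-map⁻ (x ∷_) S∈xL
...   | T , T∈L , refl = refl ∷ ∈-subsets⇒⊆ L T∈L

⊆⇒∈-subsets : ∀ {S L} → S ⊆ L → S ∈ subsets L
⊆⇒∈-subsets []         = here refl
⊆⇒∈-subsets (x ∷ʳ S⊆L) = ∈-++⁺ˡ (⊆⇒∈-subsets S⊆L)
⊆⇒∈-subsets {L = x ∷ L} (refl ∷ S⊆L) = ∈-++⁺ʳ (subsets L) (∈-map⁺ (x ∷_) (⊆⇒∈-subsets S⊆L))

max : List ℚ → ℚ
max = foldr _⊔_ 0ℚ

max-nonneg : ∀ xs → 0ℚ ≤ max xs
max-nonneg []       = ≤-refl
max-nonneg (x ∷ xs) = ≤-trans (max-nonneg xs) (p≤q⊔p x _)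

max-upper : ∀ {x xs} → x ∈ xs → x ≤ max xs
max-upper {x} (here refl)      = p≤p⊔q x _
max-upper {xs = y ∷ _} (there x∈) = ≤-trans (max-upper x∈) (p≤q⊔p y _)

max-least : ∀ {M} → 0ℚ ≤ M → ∀ {xs} → All (_≤ M) xs → max xs ≤ M
max-least 0≤M []       = 0≤M
max-least 0≤M (p ∷ ps) = ⊔-lub p (max-least 0≤M ps)

bestPacking-nonneg : ∀ L → 0ℚ ≤ bestPacking L
bestPacking-nonneg L = max-nonneg (filter (_≤? 1ℚ) (map size (subsets L)))

bestPacking-lower : ∀ {S L} → S ⊆ L → size S ≤ 1ℚ → size S ≤ bestPacking L
bestPacking-lower S⊆L fits =
  max-upper (∈-filter⁺ (_≤? 1ℚ) (∈-map⁺ size (⊆⇒∈-subsets S⊆L)) fits)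

bestPacking-upper : ∀ {M} L → 0ℚ ≤ M →
  (∀ {S} → S ⊆ L → size S ≤ 1ℚ → size S ≤ M) → bestPacking L ≤ M
bestPacking-upper L 0≤M bound = max-least 0≤M (All.tabulate below)
  where
  below : ∀ {q} → q ∈ filter (_≤? 1ℚ) (map size (subsets L)) → q ≤ _
  below q∈ with ∈-filter⁻ (_≤? 1ℚ) q∈
  ... | q∈sizes , q≤1 with ∈-map⁻ size q∈sizes
  ...   | S , S∈ , refl = bound (∈-subsets⇒⊆ L S∈) q≤1

bestPacking-mono : ∀ {L L′} → L ⊆ L′ → bestPacking L ≤ bestPacking L′
bestPacking-mono {L} {L′} L⊆L′ = bestPacking-upper L (bestPacking-nonneg L′)
  (λ S⊆L → bestPacking-lower (⊆-trans S⊆L L⊆L′))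

Heavy : ℚ → ℚ → Set
Heavy x y = 1ℚ < x + y

Bounded : ℚ → ℚ → Set
Bounded M x = (0ℚ ≤ x) × (x ≤ M)

AllPairs-resp-⊆ : ∀ {R : ℚ → ℚ → Set} {S L} → S ⊆ L → AllPairs R L → AllPairs R S
AllPairs-resp-⊆ []         []         = []
AllPairs-resp-⊆ (_ ∷ʳ S⊆L) (_ ∷ pairs) = AllPairs-resp-⊆ S⊆L pairs
AllPairs-resp-⊆ (refl ∷ S⊆L) (px ∷ pairs) = All-resp-⊆ S⊆L px ∷ AllPairs-resp-⊆ S⊆L pairs

-- A feasible set of pairwise heavy items holds at most one item.
heavy-packing : ∀ {M S} → 0ℚ ≤ M → All (Bounded M) S → AllPairs Heavy S →
  size S ≤ 1ℚ → size S ≤ M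
heavy-packing 0≤M [] _ _ = 0≤M
heavy-packing {M} _ ((_ , x≤M) ∷ []) _ _ = subst (_≤ M) (sym (+-identityʳ _)) x≤M
heavy-packing {S = x ∷ y ∷ S} _ (_ ∷ (0≤y , _) ∷ bs) ((heavy ∷ _) ∷ _) fits =
  ⊥-elim (<-irrefl refl (<-≤-trans heavy (≤-trans x+y≤size fits)))
  where
  x+y≤size : x + y ≤ x + (y + size S)
  x+y≤size = +-monoʳ-≤ x (subst (_≤ y + size S) (+-identityʳ y)
               (+-monoʳ-≤ y (size-nonneg (All.map proj₁ bs))))

bestPacking-heavy : ∀ {M L} → 0ℚ ≤ M → All (Bounded M) L → AllPairs Heavy L →
  bestPacking L ≤ M
bestPacking-heavy {L = L} 0≤M bounded pairs = bestPacking-upper L 0≤M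
  (λ S⊆L → heavy-packing 0≤M (All-resp-⊆ S⊆L bounded) (AllPairs-resp-⊆ S⊆L pairs))

runFrom-++ : ∀ A h xs ys → runFrom A h (xs ++ ys) ≡ runFrom A h xs ++ runFrom A (h ++ xs) ys
runFrom-++ A h [] ys = cong (λ h′ → runFrom A h′ ys) (sym (++-identityʳ h))
runFrom-++ A h (x ∷ xs) ys with A h x
... | true  = cong (x ∷_) rest
  where rest = trans (runFrom-++ A (h ++ [ x ]) xs ys)
                 (cong (λ h′ → runFrom A (h ++ [ x ]) xs ++ runFrom A h′ ys) (++-assoc h [ x ] xs))
... | false = trans (runFrom-++ A (h ++ [ x ]) xs ys)
                 (cong (λ h′ → runFrom A (h ++ [ x ]) xs ++ runFrom A h′ ys) (++-assoc h [ x ] xs))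

runFrom-⊆ : ∀ A h xs → runFrom A h xs ⊆ xs
runFrom-⊆ A h [] = []
runFrom-⊆ A h (x ∷ xs) with A h x
... | true  = refl ∷ runFrom-⊆ A (h ++ [ x ]) xs
... | false = x ∷ʳ runFrom-⊆ A (h ++ [ x ]) xs

buffer-rejected : ∀ A h x ys → A h x ≡ false → buffer A (h ++ x ∷ ys) ⊆ h ++ ys
buffer-rejected A h x ys rejected =
  subst (_⊆ h ++ ys) (sym (runFrom-++ A [] h (x ∷ ys)))
    (++⁺ (runFrom-⊆ A [] h) tail⊆ys)
  where
  tail⊆ys : runFrom A h (x ∷ ys) ⊆ ys
  tail⊆ys rewrite rejected = runFrom-⊆ A (h ++ [ x ]) ys

prefix : (ℕ → ℚ) → ℕ → List ℚ
prefix x zero    = []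
prefix x (suc n) = prefix x n ++ [ x n ]

All-prefix : ∀ {P : ℚ → Set} x n → (∀ {i} → i ℕ.< n → P (x i)) → All P (prefix x n)
All-prefix x zero    _  = []
All-prefix x (suc n) px = All.++⁺ (All-prefix x n (λ i<n → px (ℕ.m<n⇒m<1+n i<n))) (px ℕ.≤-refl ∷ [])

AllPairs-prefix : ∀ {R : ℚ → ℚ → Set} x n → (∀ {i j} → i ℕ.< j → R (x i) (x j)) →
  AllPairs R (prefix x n)
AllPairs-prefix x zero    _ = []
AllPairs-prefix x (suc n) r =
  AllPairs.++⁺ (AllPairs-prefix x n r) ([] ∷ []) (All-prefix x n (λ i<n → r i<n ∷ []))

accept-all-or-reject : ∀ A x n →
  (buffer A (prefix x n) ≡ prefix x n) ⊎ ∃ λ k → A (prefix x k) (x k) ≡ false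
accept-all-or-reject A x zero = inj₁ refl
accept-all-or-reject A x (suc n) with accept-all-or-reject A x n
... | inj₂ rejection = inj₂ rejection
... | inj₁ all-accepted with A (prefix x n) (x n) in decision
...   | false = inj₂ (n , decision)
...   | true  = inj₁ (trans (runFrom-++ A [] (prefix x n) [ x n ]) step)
  where
  step : buffer A (prefix x n) ++ runFrom A (prefix x n) [ x n ] ≡ prefix x (suc n)
  step rewrite all-accepted | decision = refl

module Adversary (η : ℚ) (0<η : 0ℚ < η) (η<½ : η < ½) where

  excess : ℕ → ℚ
  excess zero    = η
  excess (suc j) = excess j * ½

  excess-pos : ∀ j → 0ℚ < excess j
  excess-pos zero    = 0<η
  excess-pos (suc j) = 0<* (excess-pos j) (literal< 0ℚ ½)

  halving : ∀ j → excess (suc j) < excess j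
  halving j = subst (excess j * ½ <_) (*-identityʳ (excess j))
    (*-monoʳ-<-pos (excess j) {{positive (excess-pos j)}} (literal< ½ 1ℚ))

  excess-decreasing : ∀ {i k} → i ℕ.< k → excess k < excess i
  excess-decreasing {i} {suc k} (ℕ.s≤s i≤k) with ℕ.m≤n⇒m<n∨m≡n i≤k
  ... | inj₁ i<k  = <-trans (halving k) (excess-decreasing i<k)
  ... | inj₂ refl = halving k

  excess≤η : ∀ j → excess j ≤ η
  excess≤η zero    = ≤-refl
  excess≤η (suc j) = ≤-trans (<⇒≤ (halving j)) (excess≤η j)

  -- The target ALG value: the algorithm keeps at most one item of size ≤ M.
  M : ℚ
  M = ½ + η

  item : ℕ → ℚ
  item j = ½ + excess j

  complement : ℕ → ℚ
  complement k = ½ - excess k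

  ½<item : ∀ j → ½ < item j
  ½<item j = subst (_< item j) (+-identityʳ ½) (+-monoʳ-< ½ (excess-pos j))

  item-bounded : ∀ j → Bounded M (item j)
  item-bounded j = <⇒≤ (<-trans (literal< 0ℚ ½) (½<item j)) , +-monoʳ-≤ ½ (excess≤η j)

  complement-bounded : ∀ k → Bounded M (complement k)
  complement-bounded k = <⇒≤ (0<q-p (≤-<-trans (excess≤η k) η<½)) , complement≤M
    where
    complement≤M : complement k ≤ M
    complement≤M = +-mono-≤ (≤-refl {½})
      (≤-trans (<⇒≤ (neg-antimono-< (excess-pos k))) (<⇒≤ 0<η))

  0≤M : 0ℚ ≤ M
  0≤M = ≤-trans (proj₁ (item-bounded 0)) (proj₂ (item-bounded 0))

  M<1 : M < 1ℚ
  M<1 = +-monoʳ-< ½ η<½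

  valid : ∀ {x} → Bounded M x → 0ℚ < x → ValidItem x
  valid (_ , x≤M) 0<x = 0<x , ≤-trans x≤M (<⇒≤ M<1)

  item-valid : ∀ j → ValidItem (item j)
  item-valid j = valid (item-bounded j) (<-trans (literal< 0ℚ ½) (½<item j))

  complement-valid : ∀ k → ValidItem (complement k)
  complement-valid k = valid (complement-bounded k) (0<q-p (≤-<-trans (excess≤η k) η<½))

  items-heavy : ∀ i j → Heavy (item i) (item j)
  items-heavy i j = subst (_< item i + item j) (+-identityʳ 1ℚ)
    (+-mono-< (½<item i) (½<item j) )

  -- aᵢ + bₖ = 1 + (ηᵢ - ηₖ) > 1 for i < k.
  item-complement-heavy : ∀ {i k} → i ℕ.< k → Heavy (item i) (complement k)
  item-complement-heavy {i} {k} i<k =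
    subst₂ _<_ (+-identityʳ 1ℚ) (sym (item+complement (excess i) (excess k)))
      (+-monoʳ-< 1ℚ (0<q-p (excess-decreasing i<k)))
    where
    item+complement : ∀ x y → (½ + x) + (½ - y) ≡ 1ℚ + (x - y)
    item+complement = solve 2 (λ x y → (con ½ :+ x) :+ (con ½ :- y) := con 1ℚ :+ (x :- y)) refl

  prefix-size : ∀ n → nat n ≤ size (prefix item (n ℕ.* 2))
  prefix-size zero    = ≤-refl
  prefix-size (suc n) = subst (nat n + 1ℚ ≤_) (sym size-step)
      (+-mono-≤ (prefix-size n) (<⇒≤ (items-heavy (n ℕ.* 2) (suc (n ℕ.* 2)))))
    where
    m = n ℕ.* 2
    size-step : size (prefix item (suc (suc m))) ≡ size (prefix item m) + (item m + item (suc m))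
    size-step = begin
      size ((prefix item m ++ [ item m ]) ++ [ item (suc m) ])
        ≡⟨ cong size (++-assoc (prefix item m) [ item m ] [ item (suc m) ]) ⟩
      size (prefix item m ++ item m ∷ item (suc m) ∷ [])
        ≡⟨ size-++ (prefix item m) _ ⟩
      size (prefix item m) + (item m + (item (suc m) + 0ℚ))
        ≡⟨ cong (λ z → size (prefix item m) + (item m + z)) (+-identityʳ _) ⟩
      size (prefix item m) + (item m + item (suc m)) ∎
      where open ≡-Reasoning

  -- A feasible algorithm rejects some item aₖ; the instance a₀,…,aₖ,bₖ
  -- then has OPT ≥ 1 but ALG ≤ M.
  adversary : ∀ A R → Feasible R A →
    ∃ λ I → ValidInstance I × (ALG A I ≤ M) × (1ℚ ≤ OPT I)
  adversary A R feasible with archimedean R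
  ... | n , R<n with accept-all-or-reject A item (n ℕ.* 2)
  ...   | inj₁ all-accepted = ⊥-elim (<-irrefl refl (<-≤-trans R<n
            (≤-trans (prefix-size n) (subst (λ B → size B ≤ R) all-accepted
              (feasible _ (All-prefix item (n ℕ.* 2) (λ {i} _ → item-valid i)))))))
  ...   | inj₂ (k , rejected) =
          prefix item k ++ tail
        , All.++⁺ (All-prefix item k (λ {i} _ → item-valid i)) (item-valid k ∷ complement-valid k ∷ [])
        , ≤-trans (bestPacking-mono (buffer-rejected A (prefix item k) (item k) _ rejected)) survivors≤M
        , subst (_≤ OPT (prefix item k ++ tail)) tail-size
            (bestPacking-lower (++⁺ˡ (prefix item k) ⊆-refl) (≤-reflexive tail-size))
    where
    tail : List ℚ
    tail = item k ∷ complement k ∷ []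

    tail-size : size tail ≡ 1ℚ
    tail-size = solve 1 (λ x → (con ½ :+ x) :+ ((con ½ :- x) :+ con 0ℚ) := con 1ℚ) refl (excess k)

    survivors≤M : bestPacking (prefix item k ++ [ complement k ]) ≤ M
    survivors≤M = bestPacking-heavy 0≤M
      (All.++⁺ (All-prefix item k (λ {i} _ → item-bounded i)) (complement-bounded k ∷ []))
      (AllPairs.++⁺ (AllPairs-prefix item k (λ {i} {j} _ → items-heavy i j)) ([] ∷ [])
        (All-prefix item k (λ i<k → item-complement-heavy i<k ∷ [])))

-- For c < 2 there is an admissible η with c·x < 1 whenever 0 ≤ x ≤ ½ + η.
-- For c > 0 take η = (2 - c)/8: then 1 - c(½ + η) = (2 - c)(4 - c)/8 > 0.
ratio-margin : ∀ c → c < two →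
  ∃ λ η → (0ℚ < η) × (η < ½) × (∀ x → 0ℚ ≤ x → x ≤ ½ + η → c * x < 1ℚ)
ratio-margin c c<2 with c ≤? 0ℚ
... | yes c≤0 = ½ * ½ , literal< 0ℚ (½ * ½) , literal< (½ * ½) ½ , small
  where
  small : ∀ x → 0ℚ ≤ x → x ≤ ½ + ½ * ½ → c * x < 1ℚ
  small x 0≤x _ = ≤-<-trans
    (subst (c * x ≤_) (*-zeroʳ c) (*-monoˡ-≤-nonPos c {{nonPositive c≤0}} 0≤x))
    (literal< 0ℚ 1ℚ)
... | no c≰0 = η , 0<η , η<½ , small
  where
  0<c : 0ℚ < c
  0<c = ≰⇒> c≰0

  ⅛ : ℚ
  ⅛ = ½ * (½ * ½)

  η : ℚ
  η = (two - c) * ⅛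

  0<η : 0ℚ < η
  0<η = 0<* (0<q-p c<2) (literal< 0ℚ ⅛)

  η<½ : η < ½
  η<½ = <-trans (*-monoˡ-<-pos ⅛ (p-e<p 0<c)) (literal< (two * ⅛) ½)

  margin : 1ℚ - c * (½ + η) ≡ (two - c) * ((two + two - c) * ⅛)
  margin = solve 1 (λ c → con 1ℚ :- c :* (con ½ :+ (con two :- c) :* con ⅛)
                          := (con two :- c) :* ((con two :+ con two :- c) :* con ⅛)) refl c

  c[½+η]<1 : c * (½ + η) < 1ℚ
  c[½+η]<1 = 0<q-p⇒p<q (subst (0ℚ <_) (sym margin)
    (0<* (0<q-p c<2) (0<* (0<q-p (<-trans c<2 (literal< two (two + two)))) (literal< 0ℚ ⅛))))

  small : ∀ x → 0ℚ ≤ x → x ≤ ½ + η → c * x < 1ℚ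
  small x _ x≤½+η = ≤-<-trans (*-monoˡ-≤-nonNeg c {{nonNegative (<⇒≤ 0<c)}} x≤½+η) c[½+η]<1

theorem3 : (R : ℚ) → three-halves < R → (ε : ℚ) → 0ℚ < ε →
    (A : OnlineAlg) → Feasible R A → RatioAtLeast A (two - ε)
theorem3 R _ ε 0<ε A feasible c c<2-ε
  with ratio-margin c (<-trans c<2-ε (p-e<p 0<ε))
... | η , 0<η , η<½ , c·ALG<1 with Adversary.adversary η 0<η η<½ A R feasible
...   | I , valid , ALG≤½+η , 1≤OPT =
        I , valid , <-≤-trans (c·ALG<1 (ALG A I) (bestPacking-nonneg (buffer A I)) ALG≤½+η) 1≤OPT
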